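{- Let $(G_1,+)$ and $(G_2,+)$ be abelian groups and let $k$ be a positive integer. Suppose that every nice subset of $G_2$ of size $k$ admits an Alspach ordering. Let $A$ be a nice subset of $G_1$ of size $k$, and suppose there exists a group homomorphism $\varphi: G_1\to G_2$ such that $\ker(\varphi)\cap \Upsilon(A)=\emptyset$, where $\Upsilon(A)=A\cup\{x_1-x_2 : x_1,x_2\in A,\ x_1\neq x_2\}\cup\{\sum_{z\in A} z\}$. Then $A$ admits an Alspach ordering.
   Context: A finite subset $A$ of an abelian group $G$ is called nice if $0_G\notin A$ and $\sum_{z\in A} z\neq 0_G$. For a finite subset $A=\{x_1,\dots,x_k\}$ of $G$ and an ordering $\omega=(x_{j_1},\dots,x_{j_k})$ of its elements, the partial sums are $s_i(\omega)=x_{j_1}+\dots+x_{j_i}$ for $i=1,\dots,k$. An ordering $\omega$ of $A$ is called an Alspach ordering if $s_i(\omega)\neq 0_G$ for all $i$ and $s_i(\omega)\neq s_j(\omega)$ for all $1\le i<j\le k$. -}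

module Defs where

open import Level using (Level)
open import Algebra.Bundles using (AbelianGroup)
open import Algebra.Morphism.Structures using (IsGroupHomomorphism)
open import Data.Nat using (ℕ; suc; _<_)
open import Data.Fin using (Fin; toℕ)
open import Data.List using (List; []; _∷_; length; take; foldr)
open import Data.List.Membership.Propositional using (_∈_)
open import Data.List.Relation.Binary.Permutation.Propositional using (_↭_)
import Data.List.Relation.Unary.Unique.Setoid as UniqueS
open import Data.Product using (_×_; Σ)
open import Relation.Nullary using (¬_)

-- Notions relative to an abelian group G (written multiplicatively in the
-- stdlib record: _∙_ is the group operation "+", ε is 0_G, _⁻¹ is negation).
module _ {c ℓ : Level} (G : AbelianGroup c ℓ) where
  open AbelianGroup G

  Σ⟨_⟩ : List Carrier → Carrier
  Σ⟨ xs ⟩ = foldr _∙_ ε xs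

  -- A finite subset of G is represented by a duplicate-free list (w.r.t. ≈).
  IsFinSubset : List Carrier → Set (c Level.⊔ ℓ)
  IsFinSubset A = UniqueS.Unique setoid A

  Nice : List Carrier → Set (c Level.⊔ ℓ)
  Nice A = (∀ {x} → x ∈ A → ¬ (x ≈ ε)) × ¬ (Σ⟨ A ⟩ ≈ ε)

  -- partial sum s_i(ω) = x_{j_1} + ... + x_{j_i}, for i = suc (toℕ i') ∈ {1..k}
  partialSum : (ω : List Carrier) → Fin (length ω) → Carrier
  partialSum ω i = Σ⟨ take (suc (toℕ i)) ω ⟩

  IsAlspach : List Carrier → Set ℓ
  IsAlspach ω =
    (∀ i → ¬ (partialSum ω i ≈ ε)) ×
    (∀ i j → toℕ i < toℕ j → ¬ (partialSum ω i ≈ partialSum ω j))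

  AdmitsAlspach : List Carrier → Set (c Level.⊔ ℓ)
  AdmitsAlspach A = Σ (List Carrier) λ ω → (ω ↭ A) × IsAlspach ω

module _ {c₁ ℓ₁ c₂ ℓ₂ : Level} (G₁ : AbelianGroup c₁ ℓ₁) (G₂ : AbelianGroup c₂ ℓ₂) where
  private
    module G₁ = AbelianGroup G₁
    module G₂ = AbelianGroup G₂

  IsHom : (G₁.Carrier → G₂.Carrier) → Set (c₁ Level.⊔ ℓ₁ Level.⊔ ℓ₂)
  IsHom φ = IsGroupHomomorphism G₁.rawGroup G₂.rawGroup φ

  KerAvoidsΥ : (G₁.Carrier → G₂.Carrier) → List G₁.Carrier → Set (c₁ Level.⊔ ℓ₁ Level.⊔ ℓ₂)
  KerAvoidsΥ φ A =
    (∀ {x} → x ∈ A → ¬ (φ x G₂.≈ G₂.ε)) ×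
    (∀ {x₁ x₂} → x₁ ∈ A → x₂ ∈ A → ¬ (x₁ G₁.≈ x₂) →
       ¬ (φ (x₁ G₁.∙ (x₂ G₁.⁻¹)) G₂.≈ G₂.ε)) ×
    ¬ (φ (Σ⟨_⟩ G₁ A) G₂.≈ G₂.ε)

-- Since φ does not vanish on differences of distinct elements of A, it is injective
-- on A, and as it also avoids 0 on A and on Σ A, the image φ(A) is a nice k-subset
-- of G₂. An Alspach ordering of φ(A) lifts along the permutation to an ordering ω of A
-- with φ(ω) equal to it; partial sums commute with φ, so a zero partial sum or two
-- equal partial sums of ω would survive in φ(ω).
module Submission where

open import Defs
open import Level using (Level)
open import Algebra.Bundles using (AbelianGroup)
open import Algebra.Morphism.Structures using (module IsGroupHomomorphism)
open import Data.Nat using (ℕ; suc; _≤_; _<_)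
open import Data.Fin using (Fin; toℕ; cast)
open import Data.Fin.Properties using (toℕ-cast)
open import Data.List using (List; []; _∷_; length; map; take)
open import Data.List.Properties using (length-map; take-map)
open import Data.List.Membership.Propositional using (_∈_)
open import Data.List.Membership.Propositional.Properties using (∈-map⁻)
open import Data.List.Relation.Unary.Any using (here; there)
import Data.List.Relation.Unary.All as All
import Data.List.Relation.Unary.All.Properties as All
open import Data.List.Relation.Unary.AllPairs using ([]; _∷_)
import Data.List.Relation.Unary.Unique.Setoid as UniqueS
open import Data.List.Relation.Binary.Permutation.Propositional using (_↭_; ↭-sym)
open import Data.List.Relation.Binary.Permutation.Propositional.Properties using (↭-map-inv)
open import Data.Product using (Σ; _×_; _,_; proj₁; proj₂)
open import Relation.Binary.Bundles using (Setoid)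
open import Relation.Binary.PropositionalEquality as ≡ using (_≡_)
open import Relation.Nullary using (¬_)

module _ {a b ℓ₁ ℓ₂ : Level} (S : Setoid a ℓ₁) (T : Setoid b ℓ₂) where
  private
    module S = Setoid S
    module T = Setoid T

  Unique-map⁺-onMembers : ∀ {f : S.Carrier → T.Carrier} {xs} →
    (∀ {x y} → x ∈ xs → y ∈ xs → ¬ x S.≈ y → ¬ f x T.≈ f y) →
    UniqueS.Unique S xs → UniqueS.Unique T (map f xs)
  Unique-map⁺-onMembers {xs = []}     sep []           = []
  Unique-map⁺-onMembers {xs = x ∷ xs} sep (x∉ ∷ xs!) =
    All.map⁺ (All.tabulate λ y∈ → sep (here ≡.refl) (there y∈) (All.lookup x∉ y∈))
    ∷ Unique-map⁺-onMembers (λ x∈ y∈ → sep (there x∈) (there y∈)) xs!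

module _ {c₁ ℓ₁ c₂ ℓ₂ : Level} (G₁ : AbelianGroup c₁ ℓ₁) (G₂ : AbelianGroup c₂ ℓ₂)
         {φ : AbelianGroup.Carrier G₁ → AbelianGroup.Carrier G₂} (hom : IsHom G₁ G₂ φ) where
  private
    module G₁ = AbelianGroup G₁
    module G₂ = AbelianGroup G₂
  open IsGroupHomomorphism hom

  Σ-homo : ∀ xs → φ (Σ⟨ G₁ ⟩ xs) G₂.≈ Σ⟨ G₂ ⟩ (map φ xs)
  Σ-homo []       = ε-homo
  Σ-homo (x ∷ xs) = G₂.trans (homo x (Σ⟨ G₁ ⟩ xs)) (G₂.∙-congˡ (Σ-homo xs))

  partialSum-homo : ∀ ω (i : Fin (length ω)) →
    φ (partialSum G₁ ω i) G₂.≈ partialSum G₂ (map φ ω) (cast (≡.sym (length-map φ ω)) i)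
  partialSum-homo ω i
    rewrite toℕ-cast (≡.sym (length-map φ ω)) i | take-map {f = φ} (suc (toℕ i)) ω
    = Σ-homo (take (suc (toℕ i)) ω)

  ≈-homo⇒difference-in-kernel : ∀ {x y} → φ x G₂.≈ φ y → φ (x G₁.∙ y G₁.⁻¹) G₂.≈ G₂.ε
  ≈-homo⇒difference-in-kernel {x} {y} φx≈φy = begin
    φ (x G₁.∙ y G₁.⁻¹)   ≈⟨ homo x (y G₁.⁻¹) ⟩
    φ x G₂.∙ φ (y G₁.⁻¹) ≈⟨ G₂.∙-cong φx≈φy (⁻¹-homo y) ⟩
    φ y G₂.∙ φ y G₂.⁻¹   ≈⟨ G₂.inverseʳ (φ y) ⟩
    G₂.ε                 ∎
    where open import Relation.Binary.Reasoning.Setoid G₂.setoid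

  module _ {A : List G₁.Carrier} (avoids : KerAvoidsΥ G₁ G₂ φ A) where
    private
      φx≉ε    = proj₁ avoids
      φdiff≉ε = proj₁ (proj₂ avoids)
      φΣ≉ε    = proj₂ (proj₂ avoids)

    IsFinSubset-map : IsFinSubset G₁ A → IsFinSubset G₂ (map φ A)
    IsFinSubset-map = Unique-map⁺-onMembers G₁.setoid G₂.setoid
      λ x∈ y∈ x≉y φx≈φy → φdiff≉ε x∈ y∈ x≉y (≈-homo⇒difference-in-kernel φx≈φy)

    Nice-map : Nice G₂ (map φ A)
    Nice-map = φ-nonzero , λ ΣφA≈ε → φΣ≉ε (G₂.trans (Σ-homo A) ΣφA≈ε)
      where
      φ-nonzero : ∀ {y} → y ∈ map φ A → ¬ y G₂.≈ G₂.ε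
      φ-nonzero y∈ y≈ε with x , x∈ , ≡.refl ← ∈-map⁻ φ y∈ = φx≉ε x∈ y≈ε

  IsAlspach-map⁻ : ∀ ω → IsAlspach G₂ (map φ ω) → IsAlspach G₁ ω
  IsAlspach-map⁻ ω (sᵢ≉ε , sᵢ≉sⱼ) =
    (λ i sᵢ≈ε → sᵢ≉ε (lift i)
       (G₂.trans (G₂.sym (partialSum-homo ω i)) (G₂.trans (⟦⟧-cong sᵢ≈ε) ε-homo))) ,
    (λ i j i<j sᵢ≈sⱼ → sᵢ≉sⱼ (lift i) (lift j)
       (≡.subst₂ _<_ (≡.sym (toℕ-cast eq i)) (≡.sym (toℕ-cast eq j)) i<j)
       (G₂.trans (G₂.sym (partialSum-homo ω i)) (G₂.trans (⟦⟧-cong sᵢ≈sⱼ) (partialSum-homo ω j))))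
    where
    eq = ≡.sym (length-map φ ω)
    lift = cast eq

  AdmitsAlspach-map⁻ : ∀ A → AdmitsAlspach G₂ (map φ A) → AdmitsAlspach G₁ A
  AdmitsAlspach-map⁻ A (ω₂ , ω₂↭φA , alspach)
    with ω , ≡.refl , A↭ω ← ↭-map-inv φ (↭-sym ω₂↭φA)
    = ω , ↭-sym A↭ω , IsAlspach-map⁻ ω alspach

lemma2p1 : {c₁ ℓ₁ c₂ ℓ₂ : Level} (G₁ : AbelianGroup c₁ ℓ₁) (G₂ : AbelianGroup c₂ ℓ₂)
    (k : ℕ) → 1 ≤ k →
    ((B : List (AbelianGroup.Carrier G₂)) → IsFinSubset G₂ B → length B ≡ k →
      Nice G₂ B → AdmitsAlspach G₂ B) →
    (A : List (AbelianGroup.Carrier G₁)) → IsFinSubset G₁ A → length A ≡ k →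
    Nice G₁ A →
    (Σ (AbelianGroup.Carrier G₁ → AbelianGroup.Carrier G₂) λ φ →
      IsHom G₁ G₂ φ × KerAvoidsΥ G₁ G₂ φ A) →
    AdmitsAlspach G₁ A
lemma2p1 G₁ G₂ k _ alspach₂ A A-set |A|≡k _ (φ , hom , avoids) =
  AdmitsAlspach-map⁻ G₁ G₂ hom A
    (alspach₂ (map φ A)
      (IsFinSubset-map G₁ G₂ hom avoids A-set)
      (≡.trans (length-map φ A) |A|≡k)
      (Nice-map G₁ G₂ hom avoids))
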